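{- For every even $n\ge 4$, $$f_n\bigl(\{2,3,\dots,\tfrac n2\}\bigr)=2^{n-1}+\sum_{i=1}^{\frac n2-1}\sum_{j=1}^{\frac n2-1}\binom{i+j-2}{i-1}2^{n-i-j-2}.$$
   Context: The set of alternatives is $[n]=\{1,\dots,n\}$ with its natural order. For a triple $i<j<k$, the never condition $1N3$ on a set of linear orders means that in every order, $i$ is not ranked last among $i,j,k$; $3N1$ means that $k$ is not ranked first among $i,j,k$. For $B\subseteq[n]$, the set-alternating scheme generated by $B$ assigns to each triple $i<j<k$ the condition $1N3$ if $j\in B$ and $3N1$ if $j\notin B$; $D_{[n]}(B)$ is the set of all linear orders on $[n]$ satisfying all assigned conditions, and $f_n(B)=|D_{[n]}(B)|$. -}

module Defs where

open import Data.Nat using (ℕ; zero; suc; _+_; _*_; _∸_; _^_; _≤_; _<_)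
open import Data.Nat.Combinatorics using (_C_)
open import Data.List using (List; []; _∷_; _++_; map; upTo; length)
open import Data.Nat.ListAction using (sum)
open import Data.List.Membership.Propositional using (_∈_)
open import Data.List.Relation.Unary.Unique.Propositional using (Unique)
open import Data.List.Relation.Binary.Permutation.Propositional using (_↭_)
open import Data.Product using (Σ; _×_; ∃; ∃-syntax)
open import Relation.Nullary using (¬_)
open import Relation.Binary.PropositionalEquality using (_≡_)
open import Function.Bundles using (_⇔_)

-- A linear order on [n] = {1,…,n} is represented as a list σ that is a
-- permutation of [1,…,n]; the head of the list is ranked first (highest),
-- the last element is ranked last.

oneTo : ℕ → List ℕ
oneTo n = map suc (upTo n)

IsLinearOrder : ℕ → List ℕ → Set
IsLinearOrder n σ = σ ↭ oneTo n

_≺[_]_ : ℕ → List ℕ → ℕ → Set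
a ≺[ σ ] b = ∃[ xs ] ∃[ ys ] (σ ≡ xs ++ (a ∷ ys) × b ∈ ys)

N13 : List ℕ → ℕ → ℕ → ℕ → Set
N13 σ i j k = ¬ (j ≺[ σ ] i × k ≺[ σ ] i)

N31 : List ℕ → ℕ → ℕ → ℕ → Set
N31 σ i j k = ¬ (k ≺[ σ ] i × k ≺[ σ ] j)

SatScheme : ℕ → (ℕ → Set) → List ℕ → Set
SatScheme n B σ =
  ∀ i j k → 1 ≤ i → i < j → j < k → k ≤ n →
    (B j → N13 σ i j k) × (¬ B j → N31 σ i j k)

InD : ℕ → (ℕ → Set) → List ℕ → Set
InD n B σ = IsLinearOrder n σ × SatScheme n B σ

-- f_n(B) = c : D_[n](B) has exactly c elements, i.e. it is enumerated
-- without repetition by a list of length c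
fIs : ℕ → (ℕ → Set) → ℕ → Set
fIs n B c = Σ (List (List ℕ)) λ L →
  Unique L × (∀ σ → (σ ∈ L) ⇔ InD n B σ) × length L ≡ c

-- Σ_{i=a}^{b} f i  (empty if b < a)
sumFromTo : ℕ → ℕ → (ℕ → ℕ) → ℕ
sumFromTo a b f = sum (map (λ t → f (a + t)) (upTo (suc b ∸ a)))

B2to : ℕ → ℕ → Set
B2to m j = 2 ≤ j × j ≤ m

rhs : ℕ → ℕ
rhs m = 2 ^ (n ∸ 1) +
  sumFromTo 1 (m ∸ 1) (λ i → sumFromTo 1 (m ∸ 1) (λ j →
    ((i + j ∸ 2) C (i ∸ 1)) * 2 ^ (n ∸ i ∸ j ∸ 2)))
  where n = 2 * m

-- Call 1, …, m low and m + 1, …, 2m high, and build an order from its first element.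
-- An order of r ≥ 1 high elements alone is valid exactly when each element is the least or the
-- second least of those not yet placed, which gives 2^(r-1) orders.  In a valid order of
-- {x, …, 2m} the first element is either a low c, immediately followed by x, …, c - 1 in
-- increasing order and then by a valid order of {c + 1, …, 2m}; or it is m + 1, after which the
-- remaining lows occur in increasing order and, as long as lows remain, the next element is the
-- least remaining low or the least remaining high.  Counting these three families gives a
-- recurrence of the form f (p + 1) = 2 f p + g p, where g p counts interleavings of lows with
-- high orders; solving it yields the double sum of binomial coefficients.
module Submission where

open import Defs
open import Data.Empty using (⊥; ⊥-elim)
open import Data.List using (List; []; _∷_; _++_; [_]; map; length; applyUpTo)
open import Data.List.Properties using (length-++; length-map; ∷-injectiveˡ; ∷-injectiveʳ; map-upTo)
open import Data.List.Membership.Propositional using (_∈_; _∉_)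
open import Data.List.Membership.Propositional.Properties
  using (∈-++⁺ʳ; ∈-++⁺ˡ; ∈-++⁻; ∈-map⁺; ∈-map⁻; ∈-upTo⁺; ∈-upTo⁻)
open import Data.List.Membership.Propositional.Properties.WithK using (unique∧set⇒bag)
open import Data.List.Relation.Binary.BagAndSetEquality using (∼bag⇒↭)
open import Data.List.Relation.Binary.Disjoint.Propositional using (Disjoint)
open import Data.List.Relation.Binary.Permutation.Propositional using (_↭_; ↭-sym; ↭⇒↭ₛ′)
open import Data.List.Relation.Binary.Permutation.Propositional.Properties using (∈-resp-↭)
import Data.List.Relation.Binary.Permutation.Setoid.Properties as ↭ₛ
open import Data.List.Relation.Unary.All using ([])
open import Data.List.Relation.Unary.All.Properties using (¬Any⇒All¬)
open import Data.List.Relation.Unary.AllPairs using ([]; _∷_)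
open import Data.List.Relation.Unary.Any using (here; there)
open import Data.List.Relation.Unary.Unique.Propositional using (Unique)
open import Data.List.Relation.Unary.Unique.Propositional.Properties using (Unique[x∷xs]⇒x∉xs; map⁺; ++⁺; upTo⁺)
open import Data.Nat using (ℕ; zero; suc; _+_; _*_; _∸_; _^_; _≤_; _<_; z≤n; s≤s; z<s; s<s; _≟_)
open import Data.Nat.Combinatorics using (_C_; nCn≡1; nCk+nC[k+1]≡[n+1]C[k+1])
open import Data.Nat.ListAction using (sum)
open import Data.Nat.Properties
open import Data.Nat.Tactic.RingSolver using (solve-∀)
open import Data.Product using (_×_; _,_; proj₁; proj₂; ∃-syntax)
open import Data.Sum using (_⊎_; inj₁; inj₂; [_,_]′; assocʳ; assocˡ; map₂; fromInj₁)
import Data.Sum as Sum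
open import Function using (_∘_; case_of_; _⇔_; mk⇔; Equivalence)
open import Relation.Binary.Definitions using (tri<; tri≈; tri>)
open import Relation.Binary.PropositionalEquality hiding ([_])
open import Relation.Nullary using (¬_; yes; no)
open import Relation.Unary using (_≐′_; _∪_; ｛_｝)
open import Relation.Unary.Properties using (≐′-refl; ≐′-sym; ≐′-trans)
open ≡-Reasoning

≺-∷⁻ : ∀ {a b c τ} → a ≺[ c ∷ τ ] b → (a ≡ c × b ∈ τ) ⊎ a ≺[ τ ] b
≺-∷⁻ ([] , ys , refl , b∈) = inj₁ (refl , b∈)
≺-∷⁻ (x ∷ xs , ys , refl , b∈) = inj₂ (xs , ys , refl , b∈)

≺-head : ∀ {b c τ} → b ∈ τ → c ≺[ c ∷ τ ] b
≺-head {τ = τ} b∈ = [] , τ , refl , b∈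

≺-∷⁺ : ∀ {a b c τ} → a ≺[ τ ] b → a ≺[ c ∷ τ ] b
≺-∷⁺ {c = c} (xs , ys , eq , b∈) = c ∷ xs , ys , cong (c ∷_) eq , b∈

≺⇒∈ˡ : ∀ {a b τ} → a ≺[ τ ] b → a ∈ τ
≺⇒∈ˡ (xs , _ , refl , _) = ∈-++⁺ʳ xs (here refl)

≺⇒∈ʳ : ∀ {a b τ} → a ≺[ τ ] b → b ∈ τ
≺⇒∈ʳ (xs , _ , refl , b∈) = ∈-++⁺ʳ xs (there b∈)

unique-∷ : ∀ {c : ℕ} {τ} → c ∉ τ → Unique τ → Unique (c ∷ τ)
unique-∷ c∉ u = ¬Any⇒All¬ _ c∉ ∷ u

unique-tail : ∀ {c : ℕ} {τ} → Unique (c ∷ τ) → Unique τ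
unique-tail (_ ∷ u) = u

¬≺-head : ∀ {a c : ℕ} {τ} → Unique (c ∷ τ) → ¬ a ≺[ c ∷ τ ] c
¬≺-head u p with ≺-∷⁻ p
... | inj₁ (_ , c∈) = Unique[x∷xs]⇒x∉xs u c∈
... | inj₂ q = Unique[x∷xs]⇒x∉xs u (≺⇒∈ʳ q)

≺-asym : ∀ {a b : ℕ} {τ} → Unique τ → a ≺[ τ ] b → ¬ b ≺[ τ ] a
≺-asym {τ = []} _ p _ = case ≺⇒∈ˡ p of λ ()
≺-asym {τ = c ∷ τ} u p q with ≺-∷⁻ p | ≺-∷⁻ q
... | inj₁ (refl , _) | _ = ¬≺-head u q
... | inj₂ _ | inj₁ (refl , _) = ¬≺-head u p
... | inj₂ p′ | inj₂ q′ = ≺-asym (unique-tail u) p′ q′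

≺-total : ∀ {a b : ℕ} {τ} → a ∈ τ → b ∈ τ → a ≢ b → a ≺[ τ ] b ⊎ b ≺[ τ ] a
≺-total (here refl) (here refl) a≢b = ⊥-elim (a≢b refl)
≺-total (here refl) (there b∈) _ = inj₁ (≺-head b∈)
≺-total (there a∈) (here refl) _ = inj₂ (≺-head a∈)
≺-total (there a∈) (there b∈) a≢b = Sum.map ≺-∷⁺ ≺-∷⁺ (≺-total a∈ b∈ a≢b)

∪-congˡ : ∀ {A : Set} {P Q R : A → Set} → Q ≐′ R → P ∪ Q ≐′ P ∪ R
∪-congˡ (f , g) = (λ y → map₂ (f y)) , (λ y → map₂ (g y))

∪-congʳ : ∀ {A : Set} {P Q R : A → Set} → P ≐′ Q → P ∪ R ≐′ Q ∪ R
∪-congʳ (f , g) = (λ y → Sum.map₁ (f y)) , (λ y → Sum.map₁ (g y))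

∪-assoc′ : ∀ {A : Set} {P Q R : A → Set} → (P ∪ Q) ∪ R ≐′ P ∪ (Q ∪ R)
∪-assoc′ = (λ _ → assocʳ) , (λ _ → assocˡ)

∪-leftComm : ∀ {A : Set} {P Q R : A → Set} → P ∪ (Q ∪ R) ≐′ Q ∪ (P ∪ R)
∪-leftComm = (λ _ → swap₁₂) , (λ _ → swap₁₂)
  where
  swap₁₂ : ∀ {X Y Z : Set} → X ⊎ (Y ⊎ Z) → Y ⊎ (X ⊎ Z)
  swap₁₂ = [ inj₂ ∘ inj₁ , map₂ inj₂ ]′

∪-emptyˡ : ∀ {A : Set} {P Q : A → Set} → (∀ y → ¬ P y) → P ∪ Q ≐′ Q
∪-emptyˡ ¬P = (λ y → [ ⊥-elim ∘ ¬P y , (λ q → q) ]′) , (λ _ → inj₂)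

Spans : List ℕ → (ℕ → Set) → Set
Spans τ P = (λ y → y ∈ τ) ≐′ P

Spans-∷ : ∀ {c τ Q} → Spans τ Q → Spans (c ∷ τ) (｛ c ｝ ∪ Q)
Spans-∷ (f , g) = (λ { y (here refl) → inj₁ refl ; y (there y∈) → inj₂ (f y y∈) })
                , (λ { y (inj₁ refl) → here refl ; y (inj₂ q) → there (g y q) })

Spans-∷⁻ : ∀ {c τ Q} → c ∉ τ → ¬ Q c → Spans (c ∷ τ) (｛ c ｝ ∪ Q) → Spans τ Q
Spans-∷⁻ {c} {τ} {Q} c∉ ¬Qc (f , g) = to , from
  where
  to : ∀ y → y ∈ τ → Q y
  to y y∈ with f y (there y∈)
  ... | inj₁ refl = ⊥-elim (c∉ y∈)
  ... | inj₂ q = q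
  from : ∀ y → Q y → y ∈ τ
  from y q with g y (inj₂ q)
  ... | here refl = ⊥-elim (¬Qc q)
  ... | there y∈ = y∈

Spans-swap : ∀ {a b τ P} → Spans (a ∷ b ∷ τ) P → Spans (b ∷ a ∷ τ) P
Spans-swap (f , g) = (λ y → f y ∘ swap) , (λ y → swap ∘ g y)
  where
  swap : ∀ {y a b τ} → y ∈ a ∷ b ∷ τ → y ∈ b ∷ a ∷ τ
  swap (here e) = there (here e)
  swap (there (here e)) = here e
  swap (there (there y∈)) = there (there y∈)

Spans-empty : ∀ {τ Q} → (∀ y → ¬ Q y) → Spans τ Q → τ ≡ []
Spans-empty {[]} _ _ = refl
Spans-empty {c ∷ τ} ¬Q (f , _) = ⊥-elim (¬Q c (f c (here refl)))

+-sucˡ-≤ : ∀ {x r N} → x + suc r ≤ N → suc x + r ≤ N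
+-sucˡ-≤ {x} {r} {N} = subst (_≤ N) (+-suc x r)

+-sucˡ-≡ : ∀ {x r N} → x + suc r ≡ N → suc x + r ≡ N
+-sucˡ-≡ {x} {r} = trans (sym (+-suc x r))

InRange : ℕ → ℕ → ℕ → Set
InRange a r y = a ≤ y × y < a + r

InRange-zero : ∀ {a y} → ¬ InRange a 0 y
InRange-zero {a} (a≤y , y<a+0) = <-irrefl refl (≤-<-trans a≤y (subst (_ <_) (+-identityʳ a) y<a+0))

InRange-below : ∀ {a r y} → y < a → ¬ InRange a r y
InRange-below y<a (a≤y , _) = <⇒≱ y<a a≤y

InRange-start : ∀ {a r} → InRange a (suc r) a
InRange-start {a} {r} = ≤-refl , subst (a <_) (sym (+-suc a r)) (s≤s (m≤m+n a r))

InRange-suc : ∀ {a r} → InRange a (suc r) ≐′ ｛ a ｝ ∪ InRange (suc a) r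
InRange-suc {a} {r} = split , join
  where
  split : ∀ y → InRange a (suc r) y → a ≡ y ⊎ InRange (suc a) r y
  split y (a≤y , y<) with m≤n⇒m<n∨m≡n a≤y
  ... | inj₁ a<y = inj₂ (a<y , subst (y <_) (+-suc a r) y<)
  ... | inj₂ a≡y = inj₁ a≡y
  join : ∀ y → a ≡ y ⊎ InRange (suc a) r y → InRange a (suc r) y
  join y (inj₁ refl) = InRange-start
  join y (inj₂ (a<y , y<)) = <⇒≤ a<y , subst (y <_) (sym (+-suc a r)) y<

InRange-sucˡ : ∀ {x p} {R : ℕ → Set} → InRange x (suc p) ∪ R ≐′ ｛ x ｝ ∪ (InRange (suc x) p ∪ R)
InRange-sucˡ = ≐′-trans (∪-congʳ InRange-suc) ∪-assoc′

InRange-sucʳ : ∀ {y r} {L : ℕ → Set} → L ∪ InRange y (suc r) ≐′ ｛ y ｝ ∪ (L ∪ InRange (suc y) r)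
InRange-sucʳ = ≐′-trans (∪-congˡ InRange-suc) ∪-leftComm

oneTo-spans : ∀ N → Spans (oneTo N) (InRange 1 N)
oneTo-spans N = to , from
  where
  to : ∀ y → y ∈ oneTo N → InRange 1 N y
  to y y∈ with ∈-map⁻ suc y∈
  ... | t , t∈ , refl = s≤s z≤n , s≤s (∈-upTo⁻ t∈)
  from : ∀ y → InRange 1 N y → y ∈ oneTo N
  from (suc t) (_ , s≤s t<N) = ∈-map⁺ suc (∈-upTo⁺ t<N)

oneTo-unique : ∀ N → Unique (oneTo N)
oneTo-unique N = map⁺ suc-injective (upTo⁺ N)

↭⇔Unique×Spans : ∀ {σ ys : List ℕ} → Unique ys → (σ ↭ ys) ⇔ (Unique σ × Spans σ (λ y → y ∈ ys))
↭⇔Unique×Spans {σ} {ys} u = mk⇔ to from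
  where
  to : σ ↭ ys → Unique σ × Spans σ (λ y → y ∈ ys)
  to σ↭ = ↭ₛ.Unique-resp-↭ (setoid ℕ) (↭⇒↭ₛ′ isEquivalence (↭-sym σ↭)) u
        , (λ _ → ∈-resp-↭ σ↭) , (λ _ → ∈-resp-↭ (↭-sym σ↭))
  from : Unique σ × Spans σ (λ y → y ∈ ys) → σ ↭ ys
  from (uσ , (f , g)) = ∼bag⇒↭ (unique∧set⇒bag uσ u (mk⇔ (f _) (g _)))

-- Valid orders under a never-condition scheme

module Scheme (n : ℕ) (B : ℕ → Set) where

  Sat : List ℕ → Set
  Sat = SatScheme n B

  Sat-≺⊆ : ∀ {σ σ′} → (∀ {a b} → a ≺[ σ′ ] b → a ≺[ σ ] b) → Sat σ → Sat σ′
  Sat-≺⊆ f s i j k 1≤i i<j j<k k≤n =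
    (λ Bj (ji , ki) → proj₁ (s i j k 1≤i i<j j<k k≤n) Bj (f ji , f ki)) ,
    (λ ¬Bj (ki , kj) → proj₂ (s i j k 1≤i i<j j<k k≤n) ¬Bj (f ki , f kj))

  Sat-[] : Sat []
  Sat-[] _ _ _ _ _ _ _ = (λ _ (p , _) → case ≺⇒∈ˡ p of λ ()) , (λ _ (p , _) → case ≺⇒∈ˡ p of λ ())

  Sat-∷⁻ : ∀ {c τ} → Sat (c ∷ τ) → Sat τ
  Sat-∷⁻ = Sat-≺⊆ ≺-∷⁺

  Sat-drop₂ : ∀ {h x τ} → Sat (h ∷ x ∷ τ) → Sat (h ∷ τ)
  Sat-drop₂ = Sat-≺⊆ skip
    where
    skip : ∀ {a b h x τ} → a ≺[ h ∷ τ ] b → a ≺[ h ∷ x ∷ τ ] b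
    skip p with ≺-∷⁻ p
    ... | inj₁ (refl , b∈) = ≺-head (there b∈)
    ... | inj₂ p′ = ≺-∷⁺ (≺-∷⁺ p′)

  -- Each field is named after a never condition and the role (k or j) that the head c plays in it.
  record HeadCompatible (c : ℕ) (τ : List ℕ) : Set where
    field
      N31-as-k : ∀ i j → 1 ≤ i → i < j → j < c → c ≤ n → i ∈ τ → j ∈ τ → ¬ B j → ⊥
      N13-as-k : ∀ i j → 1 ≤ i → i < j → j < c → c ≤ n → i ∈ τ → j ∈ τ → B j → i ≺[ τ ] j
      N13-as-j : B c → ∀ i k → 1 ≤ i → i < c → c < k → k ≤ n → i ∈ τ → k ∈ τ → i ≺[ τ ] k

  open HeadCompatible public

  Sat-∷ : ∀ {c τ} → c ∉ τ → Unique τ → Sat τ → HeadCompatible c τ → Sat (c ∷ τ)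
  Sat-∷ {c} {τ} c∉ u s hc i j k 1≤i i<j j<k k≤n = never13 , never31
    where
    never13 : B j → ¬ (j ≺[ c ∷ τ ] i × k ≺[ c ∷ τ ] i)
    never13 Bj (ji , ki) with ≺-∷⁻ ji | ≺-∷⁻ ki
    ... | inj₁ (refl , _) | inj₁ (refl , _) = <-irrefl refl j<k
    ... | inj₁ (refl , i∈) | inj₂ ki′ = ≺-asym u (N13-as-j hc Bj i k 1≤i i<j j<k k≤n i∈ (≺⇒∈ˡ ki′)) ki′
    ... | inj₂ ji′ | inj₁ (refl , i∈) = ≺-asym u (N13-as-k hc i j 1≤i i<j j<k k≤n i∈ (≺⇒∈ˡ ji′) Bj) ji′
    ... | inj₂ ji′ | inj₂ ki′ = proj₁ (s i j k 1≤i i<j j<k k≤n) Bj (ji′ , ki′)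
    never31 : ¬ B j → ¬ (k ≺[ c ∷ τ ] i × k ≺[ c ∷ τ ] j)
    never31 ¬Bj (ki , kj) with ≺-∷⁻ ki | ≺-∷⁻ kj
    ... | inj₁ (refl , i∈) | inj₁ (_ , j∈) = N31-as-k hc i j 1≤i i<j j<k k≤n i∈ j∈ ¬Bj
    ... | inj₁ (refl , _) | inj₂ kj′ = c∉ (≺⇒∈ˡ kj′)
    ... | inj₂ ki′ | inj₁ (refl , _) = c∉ (≺⇒∈ˡ ki′)
    ... | inj₂ ki′ | inj₂ kj′ = proj₂ (s i j k 1≤i i<j j<k k≤n) ¬Bj (ki′ , kj′)

  Sat⇒HeadCompatible : ∀ {c τ} → Sat (c ∷ τ) → HeadCompatible c τ
  Sat⇒HeadCompatible {c} {τ} s = record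
    { N31-as-k = λ i j 1≤i i<j j<c c≤n i∈ j∈ ¬Bj →
        proj₂ (s i j c 1≤i i<j j<c c≤n) ¬Bj (≺-head i∈ , ≺-head j∈)
    ; N13-as-k = λ i j 1≤i i<j j<c c≤n i∈ j∈ Bj →
        ≺-or-contra i∈ j∈ (<⇒≢ i<j) λ ji → proj₁ (s i j c 1≤i i<j j<c c≤n) Bj (≺-∷⁺ ji , ≺-head i∈)
    ; N13-as-j = λ Bc i k 1≤i i<c c<k k≤n i∈ k∈ →
        ≺-or-contra i∈ k∈ (<⇒≢ (<-trans i<c c<k)) λ ki → proj₁ (s i c k 1≤i i<c c<k k≤n) Bc (≺-head i∈ , ≺-∷⁺ ki)
    }
    where
    ≺-or-contra : ∀ {a b} → a ∈ τ → b ∈ τ → a ≢ b → ¬ b ≺[ τ ] a → a ≺[ τ ] b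
    ≺-or-contra a∈ b∈ a≢b ¬ba = fromInj₁ (⊥-elim ∘ ¬ba) (≺-total a∈ b∈ a≢b)

  HeadCompatible-min : ∀ {c τ} → (∀ y → y ∈ τ → c < y) → HeadCompatible c τ
  HeadCompatible-min above = record
    { N31-as-k = λ _ j _ _ j<c _ _ j∈ _ → <-asym j<c (above j j∈)
    ; N13-as-k = λ _ j _ _ j<c _ _ j∈ _ → ⊥-elim (<-asym j<c (above j j∈))
    ; N13-as-j = λ _ i _ _ i<c _ _ i∈ _ → ⊥-elim (<-asym i<c (above i i∈))
    }

  HeadCompatible-noPairBelow : ∀ {c τ} → ¬ B c → (∀ i j → i ∈ τ → j ∈ τ → i < j → j < c → ⊥) →
                               HeadCompatible c τ
  HeadCompatible-noPairBelow ¬Bc noPair = record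
    { N31-as-k = λ i j _ i<j j<c _ i∈ j∈ _ → noPair i j i∈ j∈ i<j j<c
    ; N13-as-k = λ i j _ i<j j<c _ i∈ j∈ _ → ⊥-elim (noPair i j i∈ j∈ i<j j<c)
    ; N13-as-j = λ Bc → ⊥-elim (¬Bc Bc)
    }

  HeadCompatible-∷-min : ∀ {c x τ} → (∀ y → y ∈ τ → x < y) → (∀ j → 1 < j → j < c → B j) →
                         HeadCompatible c τ → HeadCompatible c (x ∷ τ)
  HeadCompatible-∷-min {c} {x} {τ} above B-below hc = record
    { N31-as-k = λ i j 1≤i i<j j<c _ _ _ ¬Bj → ¬Bj (B-below j (≤-<-trans 1≤i i<j) j<c)
    ; N13-as-k = λ i j 1≤i i<j j<c c≤n i∈ j∈ Bj →
        extend i∈ j∈ i<j λ i∈′ j∈′ → N13-as-k hc i j 1≤i i<j j<c c≤n i∈′ j∈′ Bj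
    ; N13-as-j = λ Bc i k 1≤i i<c c<k k≤n i∈ k∈ →
        extend i∈ k∈ (<-trans i<c c<k) (N13-as-j hc Bc i k 1≤i i<c c<k k≤n)
    }
    where
    extend : ∀ {i j} → i ∈ x ∷ τ → j ∈ x ∷ τ → i < j → (i ∈ τ → j ∈ τ → i ≺[ τ ] j) → i ≺[ x ∷ τ ] j
    extend (here refl) (here refl) i<j _ = ⊥-elim (<-irrefl refl i<j)
    extend (here refl) (there j∈) _ _ = ≺-head j∈
    extend (there i∈) (here refl) i<j _ = ⊥-elim (<-asym i<j (above _ i∈))
    extend (there i∈) (there j∈) _ ≺τ = ≺-∷⁺ (≺τ i∈ j∈)

  record Valid (P : ℕ → Set) (τ : List ℕ) : Set where
    constructor valid
    field
      unique : Unique τ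
      spans  : Spans τ P
      sat    : Sat τ

  open Valid public

  Valid-resp : ∀ {P Q τ} → P ≐′ Q → Valid P τ → Valid Q τ
  Valid-resp eq (valid u sp st) = valid u (≐′-trans sp eq) st

  Valid-[] : ∀ {Q} → (∀ y → ¬ Q y) → Valid Q []
  Valid-[] ¬Q = valid [] ((λ _ ()) , (λ y q → ⊥-elim (¬Q y q))) Sat-[]

  Valid-∈-tail : ∀ {P h τ y} → Valid P (h ∷ τ) → P y → h ≢ y → y ∈ τ
  Valid-∈-tail v Py h≢y with proj₂ (spans v) _ Py
  ... | here refl = ⊥-elim (h≢y refl)
  ... | there y∈ = y∈

  Valid-∷⁺ : ∀ {P Q c τ} → P ≐′ ｛ c ｝ ∪ Q → ¬ Q c → Valid Q τ → HeadCompatible c τ → Valid P (c ∷ τ)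
  Valid-∷⁺ {c = c} eq ¬Qc (valid u sp st) hc =
    valid (unique-∷ c∉ u) (≐′-trans (Spans-∷ sp) (≐′-sym eq)) (Sat-∷ c∉ u st hc)
    where
    c∉ : c ∉ _
    c∉ c∈ = ¬Qc (proj₁ sp c c∈)

  Valid-∷⁻ : ∀ {P Q c τ} → P ≐′ ｛ c ｝ ∪ Q → ¬ Q c → Valid P (c ∷ τ) → Valid Q τ
  Valid-∷⁻ eq ¬Qc (valid u sp st) =
    valid (unique-tail u) (Spans-∷⁻ (Unique[x∷xs]⇒x∉xs u) ¬Qc (≐′-trans sp eq)) (Sat-∷⁻ st)

  Valid-∷-min : ∀ {P Q c τ} → P ≐′ ｛ c ｝ ∪ Q → (∀ y → Q y → c < y) → Valid Q τ → Valid P (c ∷ τ)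
  Valid-∷-min {c = c} eq above v =
    Valid-∷⁺ eq (λ Qc → <-irrefl refl (above c Qc)) v
      (HeadCompatible-min (λ y y∈ → above y (proj₁ (spans v) y y∈)))

  Valid-insertSecond : ∀ {R c x τ} → (∀ y → R y → x < y) → (∀ j → 1 < j → j < c → B j) →
                       Valid R (c ∷ τ) → Valid (｛ x ｝ ∪ R) (c ∷ x ∷ τ)
  Valid-insertSecond {c = c} {x} {τ} above B-below (valid u sp st) =
    valid (unique-∷ c∉ u′) (Spans-swap (Spans-∷ sp))
          (Sat-∷ c∉ u′ (Sat-∷ x∉ (unique-tail u) (Sat-∷⁻ st) (HeadCompatible-min aboveτ))
                 (HeadCompatible-∷-min aboveτ B-below (Sat⇒HeadCompatible st)))
    where
    aboveτ : ∀ y → y ∈ τ → x < y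
    aboveτ y y∈ = above y (proj₁ sp y (there y∈))
    x∉ : x ∉ τ
    x∉ x∈ = <-irrefl refl (aboveτ x x∈)
    u′ : Unique (x ∷ τ)
    u′ = unique-∷ x∉ (unique-tail u)
    c∉ : c ∉ x ∷ τ
    c∉ (here refl) = <-irrefl refl (above c (proj₁ sp c (here refl)))
    c∉ (there c∈) = Unique[x∷xs]⇒x∉xs u c∈

  Valid-insertSecond⁻ : ∀ {R c x τ} → ¬ R x → Valid (｛ x ｝ ∪ R) (c ∷ x ∷ τ) → Valid R (c ∷ τ)
  Valid-insertSecond⁻ {c = c} {x} {τ} ¬Rx (valid u sp st) =
    valid (unique-∷ (Unique[x∷xs]⇒x∉xs u ∘ there) (unique-tail (unique-tail u)))
          (Spans-∷⁻ x∉ ¬Rx (Spans-swap sp)) (Sat-drop₂ st)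
    where
    x∉ : x ∉ c ∷ τ
    x∉ (here refl) = Unique[x∷xs]⇒x∉xs u (here refl)
    x∉ (there x∈) = Unique[x∷xs]⇒x∉xs (unique-tail u) x∈

∑ : ℕ → (ℕ → ℕ) → ℕ
∑ N f = sum (applyUpTo f N)

∑-cong : ∀ N {f g : ℕ → ℕ} → (∀ a → a < N → f a ≡ g a) → ∑ N f ≡ ∑ N g
∑-cong zero _ = refl
∑-cong (suc N) f≗g = cong₂ _+_ (f≗g 0 z<s) (∑-cong N (λ a a<N → f≗g (suc a) (s<s a<N)))

∑-*ˡ : ∀ N c (f : ℕ → ℕ) → c * ∑ N f ≡ ∑ N (λ a → c * f a)
∑-*ˡ zero c f = *-zeroʳ c
∑-*ˡ (suc N) c f = trans (*-distribˡ-+ c (f 0) (∑ N (f ∘ suc))) (cong (c * f 0 +_) (∑-*ˡ N c (f ∘ suc)))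

doubling-solution : ∀ (f g : ℕ → ℕ) → (∀ p → f (suc p) ≡ 2 * f p + g p) →
                    ∀ p → f p ≡ 2 ^ p * f 0 + ∑ p (λ a → 2 ^ (p ∸ suc a) * g a)
doubling-solution f g rec zero = sym (trans (+-identityʳ _) (*-identityˡ _))
doubling-solution f g rec (suc p) = begin
  f (suc p)                      ≡⟨ doubling-solution (f ∘ suc) (g ∘ suc) (rec ∘ suc) p ⟩
  2 ^ p * f 1 + S                ≡⟨ cong (λ z → 2 ^ p * z + S) (rec 0) ⟩
  2 ^ p * (2 * f 0 + g 0) + S    ≡⟨ regroup (2 ^ p) (f 0) (g 0) S ⟩
  2 ^ suc p * f 0 + (2 ^ p * g 0 + S) ∎
  where
  S = ∑ p (λ a → 2 ^ (p ∸ suc a) * g (suc a))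
  regroup : ∀ t x y s → t * (2 * x + y) + s ≡ 2 * t * x + (t * y + s)
  regroup = solve-∀

highCount : ℕ → ℕ
highCount zero = 1
highCount (suc r) = 2 ^ r

sortedLowCount : ℕ → ℕ → ℕ
sortedLowCount zero r = highCount r
sortedLowCount (suc p) zero = sortedLowCount p zero
sortedLowCount (suc p) (suc r) = sortedLowCount p (suc r) + sortedLowCount (suc p) r

orderCount lowFirstCount : ℕ → ℕ → ℕ
orderCount k zero = highCount (suc k)
orderCount k (suc p) = lowFirstCount k (suc p) + sortedLowCount (suc p) k
lowFirstCount k zero = 0
lowFirstCount k (suc p) = orderCount k p + lowFirstCount k p

sortedLowCount-zero : ∀ p → sortedLowCount p 0 ≡ 1
sortedLowCount-zero zero = refl
sortedLowCount-zero (suc p) = sortedLowCount-zero p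

sortedLowCount-one : ∀ r → sortedLowCount 1 r ≡ 2 ^ r
sortedLowCount-one zero = refl
sortedLowCount-one (suc r) = cong (2 ^ r +_) (trans (sortedLowCount-one r) (sym (+-identityʳ (2 ^ r))))

-- sortedLowCount (2 + a) s, computed by a recursion in s alone.
pascalDoubling : ℕ → ℕ → ℕ
pascalDoubling a zero = 1
pascalDoubling a (suc s) = 2 * pascalDoubling a s + (a + suc s) C a

pascalDoubling-zero : ∀ s → pascalDoubling 0 s + 1 ≡ 2 ^ suc s
pascalDoubling-zero zero = refl
pascalDoubling-zero (suc s) = begin
  2 * w + 1 + 1  ≡⟨ regroup w ⟩
  2 * (w + 1)    ≡⟨ cong (2 *_) (pascalDoubling-zero s) ⟩
  2 ^ suc (suc s) ∎
  where
  w = pascalDoubling 0 s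
  regroup : ∀ w → 2 * w + 1 + 1 ≡ 2 * (w + 1)
  regroup = solve-∀

pascalDoubling-suc : ∀ a s → pascalDoubling (suc a) (suc s) ≡ pascalDoubling a (suc s) + pascalDoubling (suc a) s
pascalDoubling-suc a zero = begin
  2 + suc (a + 1) C suc a                  ≡⟨ cong (λ z → 2 + suc z C suc a) (+-comm a 1) ⟩
  2 + suc (suc a) C suc a                  ≡⟨ cong (2 +_) (sym (nCk+nC[k+1]≡[n+1]C[k+1] (suc a) a)) ⟩
  2 + (suc a C a + suc a C suc a)          ≡⟨ cong (λ z → 2 + (suc a C a + z)) (nCn≡1 (suc a)) ⟩
  2 + (suc a C a + 1)                      ≡⟨ regroup (suc a C a) ⟩
  2 + suc a C a + 1                        ≡⟨ cong (λ z → 2 + z C a + 1) (+-comm 1 a) ⟩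
  2 * 1 + (a + 1) C a + 1                  ∎
  where
  regroup : ∀ c → 2 + (c + 1) ≡ 2 + c + 1
  regroup = solve-∀
pascalDoubling-suc a (suc s) = begin
  2 * pascalDoubling (suc a) (suc s) + (suc a + suc (suc s)) C suc a
    ≡⟨ cong₂ (λ u v → 2 * u + v) (pascalDoubling-suc a s) (sym pascal) ⟩
  2 * (x + y) + ((a + suc (suc s)) C a + (suc a + suc s) C suc a)
    ≡⟨ regroup x y _ _ ⟩
  (2 * x + (a + suc (suc s)) C a) + (2 * y + (suc a + suc s) C suc a) ∎
  where
  x = pascalDoubling a (suc s)
  y = pascalDoubling (suc a) s
  pascal : (a + suc (suc s)) C a + (suc a + suc s) C suc a ≡ (suc a + suc (suc s)) C suc a
  pascal = trans (cong (λ z → (a + suc (suc s)) C a + z C suc a) (sym (+-suc a (suc s))))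
                 (nCk+nC[k+1]≡[n+1]C[k+1] (a + suc (suc s)) a)
  regroup : ∀ x y u v → 2 * (x + y) + (u + v) ≡ (2 * x + u) + (2 * y + v)
  regroup = solve-∀

sortedLowCount≡pascalDoubling : ∀ a s → sortedLowCount (suc (suc a)) s ≡ pascalDoubling a s
sortedLowCount≡pascalDoubling zero zero = refl
sortedLowCount≡pascalDoubling zero (suc s) = begin
  sortedLowCount 1 (suc s) + sortedLowCount 2 s
    ≡⟨ cong₂ _+_ (sortedLowCount-one (suc s)) (sortedLowCount≡pascalDoubling zero s) ⟩
  2 ^ suc s + w     ≡⟨ cong (_+ w) (sym (pascalDoubling-zero s)) ⟩
  w + 1 + w         ≡⟨ regroup w ⟩
  2 * w + 1         ∎
  where
  w = pascalDoubling 0 s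
  regroup : ∀ w → w + 1 + w ≡ 2 * w + 1
  regroup = solve-∀
sortedLowCount≡pascalDoubling (suc a) zero = sortedLowCount-zero (suc (suc (suc a)))
sortedLowCount≡pascalDoubling (suc a) (suc s) =
  trans (cong₂ _+_ (sortedLowCount≡pascalDoubling a (suc s)) (sortedLowCount≡pascalDoubling (suc a) s))
        (sym (pascalDoubling-suc a s))

pascalDoubling-∑ : ∀ a s c → 2 ^ c * pascalDoubling a s ≡ ∑ (suc s) (λ b → ((a + b) C a) * 2 ^ (c + (s ∸ b)))
pascalDoubling-∑ a s c = begin
  2 ^ c * pascalDoubling a s
    ≡⟨ cong (2 ^ c *_) (doubling-solution (pascalDoubling a) (λ b → (a + suc b) C a) (λ _ → refl) s) ⟩
  2 ^ c * (2 ^ s * 1 + ∑ s (λ b → 2 ^ (s ∸ suc b) * ((a + suc b) C a)))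
    ≡⟨ *-distribˡ-+ (2 ^ c) _ _ ⟩
  2 ^ c * (2 ^ s * 1) + 2 ^ c * ∑ s (λ b → 2 ^ (s ∸ suc b) * ((a + suc b) C a))
    ≡⟨ cong₂ _+_ head (trans (∑-*ˡ s (2 ^ c) _) (∑-cong s (λ b _ → term b))) ⟩
  ((a + 0) C a) * 2 ^ (c + s) + ∑ s (λ b → ((a + suc b) C a) * 2 ^ (c + (s ∸ suc b))) ∎
  where
  head : 2 ^ c * (2 ^ s * 1) ≡ ((a + 0) C a) * 2 ^ (c + s)
  head rewrite +-identityʳ a | nCn≡1 a =
    trans (cong (2 ^ c *_) (*-identityʳ (2 ^ s))) (trans (sym (^-distribˡ-+-* 2 c s)) (sym (+-identityʳ _)))
  term : ∀ b → 2 ^ c * (2 ^ (s ∸ suc b) * ((a + suc b) C a)) ≡ ((a + suc b) C a) * 2 ^ (c + (s ∸ suc b))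
  term b = trans (regroup (2 ^ c) (2 ^ (s ∸ suc b)) ((a + suc b) C a))
                 (cong (((a + suc b) C a) *_) (sym (^-distribˡ-+-* 2 c (s ∸ suc b))))
    where
    regroup : ∀ t u x → t * (u * x) ≡ x * (t * u)
    regroup = solve-∀

orderCount-one : ∀ k → orderCount k 1 ≡ 2 ^ suc k
orderCount-one k = begin
  (2 ^ k + 0) + sortedLowCount 1 k  ≡⟨ cong₂ _+_ (+-identityʳ (2 ^ k)) (sortedLowCount-one k) ⟩
  2 ^ k + 2 ^ k                     ≡⟨ cong (2 ^ k +_) (sym (+-identityʳ (2 ^ k))) ⟩
  2 ^ suc k                         ∎

orderCount-suc : ∀ k p → orderCount (suc k) (suc (suc p)) ≡ 2 * orderCount (suc k) (suc p) + sortedLowCount (suc (suc p)) k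
orderCount-suc k p = begin
  (o + l) + (g₁ + g₂)   ≡⟨ regroup o l g₁ g₂ ⟩
  o + (l + g₁) + g₂     ≡⟨ cong (λ z → o + z + g₂) (sym (+-identityʳ o)) ⟩
  2 * o + g₂            ∎
  where
  o = orderCount (suc k) (suc p)
  l = lowFirstCount (suc k) (suc p)
  g₁ = sortedLowCount (suc p) (suc k)
  g₂ = sortedLowCount (suc (suc p)) k
  regroup : ∀ o l g₁ g₂ → (o + l) + (g₁ + g₂) ≡ o + (l + g₁) + g₂
  regroup = solve-∀

rhsEntry-exponent : ∀ {k a b} → a ≤ k → b ≤ k → 2 * suc (suc k) ∸ suc a ∸ suc b ∸ 2 ≡ (k ∸ a) + (k ∸ b)
rhsEntry-exponent {k} {a} {b} a≤k b≤k = begin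
  2 * suc (suc k) ∸ suc a ∸ suc b ∸ 2
    ≡⟨ trans (∸-+-assoc (2 * suc (suc k) ∸ suc a) (suc b) 2) (∸-+-assoc (2 * suc (suc k)) (suc a) (suc b + 2)) ⟩
  2 * suc (suc k) ∸ (suc a + (suc b + 2)) ≡⟨ cong (_∸ (suc a + (suc b + 2))) total ⟩
  (x + y) + (suc a + (suc b + 2)) ∸ (suc a + (suc b + 2)) ≡⟨ m+n∸n≡m (x + y) (suc a + (suc b + 2)) ⟩
  x + y ∎
  where
  x = k ∸ a
  y = k ∸ b
  double : ∀ k → 2 * suc (suc k) ≡ suc (suc k) + suc (suc k)
  double = solve-∀
  regroup : ∀ a b x y → suc (suc (a + x)) + suc (suc (b + y)) ≡ (x + y) + (suc a + (suc b + 2))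
  regroup = solve-∀
  total : 2 * suc (suc k) ≡ (x + y) + (suc a + (suc b + 2))
  total = begin
    2 * suc (suc k)                        ≡⟨ double k ⟩
    suc (suc k) + suc (suc k)
      ≡⟨ cong₂ (λ u v → suc (suc u) + suc (suc v)) (sym (m+[n∸m]≡n a≤k)) (sym (m+[n∸m]≡n b≤k)) ⟩
    suc (suc (a + x)) + suc (suc (b + y))  ≡⟨ regroup a b x y ⟩
    (x + y) + (suc a + (suc b + 2))        ∎

rhsEntry : ℕ → ℕ → ℕ → ℕ
rhsEntry m i j = ((i + j ∸ 2) C (i ∸ 1)) * 2 ^ (2 * m ∸ i ∸ j ∸ 2)

rhs≡∑∑ : ∀ m → rhs m ≡ 2 ^ (2 * m ∸ 1) + ∑ (m ∸ 1) (λ a → ∑ (m ∸ 1) (λ b → rhsEntry m (suc a) (suc b)))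
rhs≡∑∑ m = cong (2 ^ (2 * m ∸ 1) +_)
  (trans (sumFromTo-one (m ∸ 1) (λ i → sumFromTo 1 (m ∸ 1) (rhsEntry m i)))
         (∑-cong (m ∸ 1) (λ a _ → sumFromTo-one (m ∸ 1) (rhsEntry m (suc a)))))
  where
  sumFromTo-one : ∀ N h → sumFromTo 1 N h ≡ ∑ N (h ∘ suc)
  sumFromTo-one N h = cong sum (map-upTo (h ∘ suc) N)

rhsEntry-suc : ∀ {k a b} → a ≤ k → b ≤ k → rhsEntry (suc (suc k)) (suc a) (suc b) ≡ ((a + b) C a) * 2 ^ ((k ∸ a) + (k ∸ b))
rhsEntry-suc {a = a} {b} a≤k b≤k = cong₂ (λ u v → (u C a) * 2 ^ v) (cong (_∸ 1) (+-suc a b)) (rhsEntry-exponent a≤k b≤k)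

orderCount≡rhs : ∀ k → orderCount (suc k) (suc (suc k)) ≡ rhs (suc (suc k))
orderCount≡rhs k = begin
  orderCount (suc k) (suc (suc k))
    ≡⟨ doubling-solution f g (orderCount-suc k) (suc k) ⟩
  2 ^ suc k * f 0 + ∑ (suc k) (λ a → 2 ^ (k ∸ a) * g a)
    ≡⟨ cong₂ _+_ top (∑-cong (suc k) row) ⟩
  2 ^ (2 * m ∸ 1) + ∑ (suc k) (λ a → ∑ (suc k) (λ b → rhsEntry m (suc a) (suc b)))
    ≡⟨ sym (rhs≡∑∑ m) ⟩
  rhs m ∎
  where
  m = suc (suc k)
  f g : ℕ → ℕ
  f p = orderCount (suc k) (suc p)
  g p = sortedLowCount (suc (suc p)) k
  top : 2 ^ suc k * f 0 ≡ 2 ^ (2 * m ∸ 1)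
  top = begin
    2 ^ suc k * f 0      ≡⟨ cong (2 ^ suc k *_) (orderCount-one (suc k)) ⟩
    2 ^ suc k * 2 ^ m    ≡⟨ sym (^-distribˡ-+-* 2 (suc k) m) ⟩
    2 ^ (suc k + m)      ≡⟨ cong (λ z → 2 ^ (suc k + z)) (sym (+-identityʳ m)) ⟩
    2 ^ (2 * m ∸ 1)      ∎
  row : ∀ a → a < suc k → 2 ^ (k ∸ a) * g a ≡ ∑ (suc k) (λ b → rhsEntry m (suc a) (suc b))
  row a (s≤s a≤k) = begin
    2 ^ (k ∸ a) * g a                  ≡⟨ cong (2 ^ (k ∸ a) *_) (sortedLowCount≡pascalDoubling a k) ⟩
    2 ^ (k ∸ a) * pascalDoubling a k   ≡⟨ pascalDoubling-∑ a k (k ∸ a) ⟩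
    ∑ (suc k) (λ b → ((a + b) C a) * 2 ^ ((k ∸ a) + (k ∸ b)))
                                       ≡⟨ ∑-cong (suc k) (λ b b<sk → sym (rhsEntry-suc a≤k (≤-pred b<sk))) ⟩
    ∑ (suc k) (λ b → rhsEntry m (suc a) (suc b)) ∎

highOrders⁺ : ℕ → ℕ → ℕ → List (List ℕ)
highOrders⁺ s z zero = [ [ s ] ]
highOrders⁺ s z (suc r) = map (s ∷_) (highOrders⁺ z (suc z) r) ++ map (z ∷_) (highOrders⁺ s (suc z) r)

highOrders : ℕ → ℕ → List (List ℕ)
highOrders y zero = [ [] ]
highOrders y (suc r) = highOrders⁺ y (suc y) r

sortedLowOrders : ℕ → ℕ → ℕ → ℕ → List (List ℕ)
sortedLowOrders x zero y r = highOrders y r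
sortedLowOrders x (suc p) y zero = map (x ∷_) (sortedLowOrders (suc x) p y zero)
sortedLowOrders x (suc p) y (suc r) =
  map (x ∷_) (sortedLowOrders (suc x) p y (suc r)) ++ map (y ∷_) (sortedLowOrders x (suc p) (suc y) r)

insertSecond : ℕ → List ℕ → List ℕ
insertSecond x [] = []
insertSecond x (c ∷ τ) = c ∷ x ∷ τ

insertSecond-injective : ∀ {x τ τ′} → insertSecond x τ ≡ insertSecond x τ′ → τ ≡ τ′
insertSecond-injective {τ = []} {[]} _ = refl
insertSecond-injective {τ = _ ∷ _} {_ ∷ _} refl = refl

length-branches : ∀ {A : Set} (f g : A → List ℕ) xs ys → length (map f xs ++ map g ys) ≡ length xs + length ys
length-branches f g xs ys = trans (length-++ (map f xs)) (cong₂ _+_ (length-map f xs) (length-map g ys))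

unique-branches : ∀ {a b : ℕ} {xs ys} → a ≢ b → Unique xs → Unique ys → Unique (map (a ∷_) xs ++ map (b ∷_) ys)
unique-branches a≢b u v = ++⁺ (map⁺ ∷-injectiveʳ u) (map⁺ ∷-injectiveʳ v) disjoint
  where
  disjoint : Disjoint (map (_ ∷_) _) (map (_ ∷_) _)
  disjoint (σ∈ , σ∈′) with ∈-map⁻ _ σ∈ | ∈-map⁻ _ σ∈′
  ... | _ , _ , refl | _ , _ , eq = a≢b (∷-injectiveˡ eq)

length-highOrders⁺ : ∀ r s z → length (highOrders⁺ s z r) ≡ 2 ^ r
length-highOrders⁺ zero s z = refl
length-highOrders⁺ (suc r) s z = begin
  length (highOrders⁺ s z (suc r))
    ≡⟨ length-branches (s ∷_) (z ∷_) (highOrders⁺ z (suc z) r) _ ⟩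
  length (highOrders⁺ z (suc z) r) + length (highOrders⁺ s (suc z) r)
    ≡⟨ cong₂ _+_ (length-highOrders⁺ r z (suc z)) (length-highOrders⁺ r s (suc z)) ⟩
  2 ^ r + 2 ^ r
    ≡⟨ cong (2 ^ r +_) (sym (+-identityʳ (2 ^ r))) ⟩
  2 ^ suc r ∎

length-highOrders : ∀ r y → length (highOrders y r) ≡ highCount r
length-highOrders zero y = refl
length-highOrders (suc r) y = length-highOrders⁺ r y (suc y)

length-sortedLowOrders : ∀ p r x y → length (sortedLowOrders x p y r) ≡ sortedLowCount p r
length-sortedLowOrders zero r x y = length-highOrders r y
length-sortedLowOrders (suc p) zero x y =
  trans (length-map (x ∷_) (sortedLowOrders (suc x) p y zero)) (length-sortedLowOrders p zero (suc x) y)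
length-sortedLowOrders (suc p) (suc r) x y =
  trans (length-branches (x ∷_) (y ∷_) (sortedLowOrders (suc x) p y (suc r)) _)
        (cong₂ _+_ (length-sortedLowOrders p (suc r) (suc x) y) (length-sortedLowOrders (suc p) r x (suc y)))

highOrders⁺-unique : ∀ r s z → s < z → Unique (highOrders⁺ s z r)
highOrders⁺-unique zero s z _ = [] ∷ []
highOrders⁺-unique (suc r) s z s<z =
  unique-branches (<⇒≢ s<z) (highOrders⁺-unique r z (suc z) ≤-refl) (highOrders⁺-unique r s (suc z) (m<n⇒m<1+n s<z))

highOrders-unique : ∀ r y → Unique (highOrders y r)
highOrders-unique zero y = [] ∷ []
highOrders-unique (suc r) y = highOrders⁺-unique r y (suc y) ≤-refl

sortedLowOrders-unique : ∀ p r x y → x + p ≤ y → Unique (sortedLowOrders x p y r)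
sortedLowOrders-unique zero r x y _ = highOrders-unique r y
sortedLowOrders-unique (suc p) zero x y x+p<y =
  map⁺ ∷-injectiveʳ (sortedLowOrders-unique p zero (suc x) y (+-sucˡ-≤ x+p<y))
sortedLowOrders-unique (suc p) (suc r) x y x+p<y =
  unique-branches (<⇒≢ (<-≤-trans (m<m+n x z<s) x+p<y))
    (sortedLowOrders-unique p (suc r) (suc x) y (+-sucˡ-≤ x+p<y))
    (sortedLowOrders-unique (suc p) r x (suc y) (m≤n⇒m≤1+n x+p<y))

-- The scheme generated by {2, …, m}

module Enumeration (k : ℕ) where

  m : ℕ
  m = suc k

  open Scheme (2 * m) (B2to m)

  ¬B-above : ∀ {z} → m < z → ¬ B2to m z
  ¬B-above m<z (_ , z≤m) = <⇒≱ m<z z≤m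

  highOrders⁺-sound : ∀ r s z τ → s < z → m < z → τ ∈ highOrders⁺ s z r → Valid (｛ s ｝ ∪ InRange z r) τ
  highOrders⁺-sound zero s z _ _ _ (here refl) =
    Valid-∷-min ≐′-refl (λ _ → ⊥-elim ∘ InRange-zero) (Valid-[] (λ _ → InRange-zero))
  highOrders⁺-sound (suc r) s z τ s<z m<z τ∈ with ∈-++⁻ (map (s ∷_) (highOrders⁺ z (suc z) r)) τ∈
  ... | inj₁ τ∈ˡ with ∈-map⁻ (s ∷_) τ∈ˡ
  ...   | τ′ , τ′∈ , refl =
    Valid-∷-min (∪-congˡ InRange-suc) above (highOrders⁺-sound r z (suc z) τ′ ≤-refl (m<n⇒m<1+n m<z) τ′∈)
    where
    above : ∀ y → (｛ z ｝ ∪ InRange (suc z) r) y → s < y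
    above y (inj₁ refl) = s<z
    above y (inj₂ (z<y , _)) = <-trans s<z z<y
  highOrders⁺-sound (suc r) s z τ s<z m<z τ∈ | inj₂ τ∈ʳ with ∈-map⁻ (z ∷_) τ∈ʳ
  ...   | τ′ , τ′∈ , refl =
    Valid-∷⁺ InRange-sucʳ [ (λ s≡z → <-irrefl s≡z s<z) , InRange-below ≤-refl ]′ v
      (HeadCompatible-noPairBelow (¬B-above m<z) noPair)
    where
    v = highOrders⁺-sound r s (suc z) τ′ (m<n⇒m<1+n s<z) (m<n⇒m<1+n m<z) τ′∈
    onlyS : ∀ y → y ∈ τ′ → y < z → s ≡ y
    onlyS y y∈ y<z = [ (λ s≡y → s≡y) , (λ (z<y , _) → ⊥-elim (<-asym y<z z<y)) ]′ (proj₁ (spans v) y y∈)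
    noPair : ∀ i j → i ∈ τ′ → j ∈ τ′ → i < j → j < z → ⊥
    noPair i j i∈ j∈ i<j j<z = <-irrefl (trans (sym (onlyS i i∈ (<-trans i<j j<z))) (onlyS j j∈ j<z)) i<j

  highOrders⁺-complete : ∀ r s z τ → 1 ≤ s → s < z → m < z → z + r ≤ suc (2 * m) →
                         Valid (｛ s ｝ ∪ InRange z r) τ → τ ∈ highOrders⁺ s z r
  highOrders⁺-complete r s z [] _ _ _ _ v = case proj₂ (spans v) s (inj₁ refl) of λ ()
  highOrders⁺-complete zero s z (h ∷ τ′) _ _ _ _ v with proj₁ (spans v) h (here refl)
  ... | inj₂ h∈ = ⊥-elim (InRange-zero h∈)
  ... | inj₁ refl with Spans-empty (λ _ → InRange-zero) (spans (Valid-∷⁻ ≐′-refl InRange-zero v))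
  ...   | refl = here refl
  highOrders⁺-complete (suc r) s z (h ∷ τ′) 1≤s s<z m<z z+r≤ v with proj₁ (spans v) h (here refl)
  ... | inj₁ refl =
    ∈-++⁺ˡ (∈-map⁺ (s ∷_) (highOrders⁺-complete r z (suc z) τ′ (≤-trans 1≤s (<⇒≤ s<z)) ≤-refl (m<n⇒m<1+n m<z)
      (+-sucˡ-≤ z+r≤)
      (Valid-∷⁻ (∪-congˡ InRange-suc) [ (λ z≡s → <-irrefl (sym z≡s) s<z) , InRange-below (m<n⇒m<1+n s<z) ]′ v)))
  ... | inj₂ h∈ with proj₁ InRange-suc h h∈
  ...   | inj₁ refl =
    ∈-++⁺ʳ _ (∈-map⁺ (z ∷_) (highOrders⁺-complete r s (suc z) τ′ 1≤s (m<n⇒m<1+n s<z) (m<n⇒m<1+n m<z) (+-sucˡ-≤ z+r≤)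
      (Valid-∷⁻ InRange-sucʳ [ (λ s≡z → <-irrefl s≡z s<z) , InRange-below ≤-refl ]′ v)))
  ...   | inj₂ (z<h , h<) =
    ⊥-elim (N31-as-k (Sat⇒HeadCompatible (sat v)) s z 1≤s s<z z<h (≤-pred (≤-trans h< (+-sucˡ-≤ z+r≤)))
      (Valid-∈-tail v (inj₁ refl) (λ h≡s → <-asym s<z (subst (z <_) h≡s z<h)))
      (Valid-∈-tail v (inj₂ InRange-start) (λ h≡z → <-irrefl (sym h≡z) z<h)) (¬B-above m<z))

  highOrders-sound : ∀ r y τ → m ≤ y → τ ∈ highOrders y r → Valid (InRange y r) τ
  highOrders-sound zero y _ _ (here refl) = Valid-[] (λ _ → InRange-zero)
  highOrders-sound (suc r) y τ m≤y τ∈ =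
    Valid-resp (≐′-sym InRange-suc) (highOrders⁺-sound r y (suc y) τ ≤-refl (s≤s m≤y) τ∈)

  highOrders-complete : ∀ r y τ → m ≤ y → y + r ≤ suc (2 * m) → Valid (InRange y r) τ → τ ∈ highOrders y r
  highOrders-complete zero y τ _ _ v rewrite Spans-empty (λ _ → InRange-zero) (spans v) = here refl
  highOrders-complete (suc r) y τ m≤y y+r≤ v =
    highOrders⁺-complete r y (suc y) τ (≤-trans (s≤s z≤n) m≤y) ≤-refl (s≤s m≤y)
      (+-sucˡ-≤ y+r≤) (Valid-resp InRange-suc v)

  LowsIncreasing : List ℕ → Set
  LowsIncreasing τ = ∀ i j → i ∈ τ → j ∈ τ → i < j → j ≤ m → i ≺[ τ ] j

  LowsIncreasing-∷-min : ∀ {h τ} → (∀ y → y ∈ τ → h < y) → LowsIncreasing τ → LowsIncreasing (h ∷ τ)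
  LowsIncreasing-∷-min above inc i j (here refl) (here refl) i<j _ = ⊥-elim (<-irrefl refl i<j)
  LowsIncreasing-∷-min above inc i j (here refl) (there j∈) _ _ = ≺-head j∈
  LowsIncreasing-∷-min above inc i j (there i∈) (here refl) i<j _ = ⊥-elim (<-asym i<j (above i i∈))
  LowsIncreasing-∷-min above inc i j (there i∈) (there j∈) i<j j≤m = ≺-∷⁺ (inc i j i∈ j∈ i<j j≤m)

  LowsIncreasing-∷-high : ∀ {h τ} → m < h → LowsIncreasing τ → LowsIncreasing (h ∷ τ)
  LowsIncreasing-∷-high m<h inc i j (here refl) _ i<j j≤m = ⊥-elim (<-asym m<h (<-≤-trans i<j j≤m))
  LowsIncreasing-∷-high m<h inc i j (there _) (here refl) _ j≤m = ⊥-elim (<⇒≱ m<h j≤m)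
  LowsIncreasing-∷-high m<h inc i j (there i∈) (there j∈) i<j j≤m = ≺-∷⁺ (inc i j i∈ j∈ i<j j≤m)

  LowsIncreasing-∷⁻ : ∀ {h τ} → Unique (h ∷ τ) → LowsIncreasing (h ∷ τ) → LowsIncreasing τ
  LowsIncreasing-∷⁻ u inc i j i∈ j∈ i<j j≤m with ≺-∷⁻ (inc i j (there i∈) (there j∈) i<j j≤m)
  ... | inj₁ (refl , _) = ⊥-elim (Unique[x∷xs]⇒x∉xs u i∈)
  ... | inj₂ i≺j = i≺j

  HeadCompatible-high : ∀ {c τ} → m < c → (∀ j → j ∈ τ → j < c → j ≤ m) → LowsIncreasing τ → HeadCompatible c τ
  HeadCompatible-high m<c low inc = record
    { N31-as-k = λ i j 1≤i i<j j<c _ _ j∈ ¬Bj → ¬Bj (≤-<-trans 1≤i i<j , low j j∈ j<c)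
    ; N13-as-k = λ i j _ i<j j<c _ i∈ j∈ _ → inc i j i∈ j∈ i<j (low j j∈ j<c)
    ; N13-as-j = λ Bc → ⊥-elim (¬B-above m<c Bc)
    }

  HeadCompatible⇒LowsIncreasing : ∀ {c τ} → m < c → c ≤ 2 * m → (∀ y → y ∈ τ → 1 ≤ y) →
                                   HeadCompatible c τ → LowsIncreasing τ
  HeadCompatible⇒LowsIncreasing m<c c≤n pos hc i j i∈ j∈ i<j j≤m =
    N13-as-k hc i j (pos i i∈) i<j (≤-<-trans j≤m m<c) c≤n i∈ j∈ (≤-<-trans (pos i i∈) i<j , j≤m)

  sortedLow-∷-low : ∀ {x p y r τ} → x < y → Valid (InRange (suc x) p ∪ InRange y r) τ × LowsIncreasing τ →
                    Valid (InRange x (suc p) ∪ InRange y r) (x ∷ τ) × LowsIncreasing (x ∷ τ)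
  sortedLow-∷-low {x} {τ = τ} x<y (v , inc) =
    Valid-∷-min InRange-sucˡ above v , LowsIncreasing-∷-min (λ z z∈ → above z (proj₁ (spans v) z z∈)) inc
    where
    above : ∀ z → (InRange (suc x) _ ∪ InRange _ _) z → x < z
    above z (inj₁ (x<z , _)) = x<z
    above z (inj₂ (y≤z , _)) = <-≤-trans x<y y≤z

  sortedLow-∷-high : ∀ {x p y r τ} → x + p ≤ suc m → m < y →
                     Valid (InRange x p ∪ InRange (suc y) r) τ × LowsIncreasing τ →
                     Valid (InRange x p ∪ InRange y (suc r)) (y ∷ τ) × LowsIncreasing (y ∷ τ)
  sortedLow-∷-high {x} {p} {y} x+p≤ m<y (v , inc) =
    Valid-∷⁺ InRange-sucʳ [ (λ (_ , y<) → <⇒≱ m<y (≤-pred (≤-trans y< x+p≤))) , InRange-below ≤-refl ]′ v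
      (HeadCompatible-high m<y low inc) ,
    LowsIncreasing-∷-high m<y inc
    where
    low : ∀ j → j ∈ _ → j < y → j ≤ m
    low j j∈ j<y with proj₁ (spans v) j j∈
    ... | inj₁ (_ , j<) = ≤-pred (≤-trans j< x+p≤)
    ... | inj₂ (y<j , _) = ⊥-elim (<-asym j<y y<j)

  low<high : ∀ {x p y} → x + suc p ≤ suc m → suc m < y → x < y
  low<high {x} x+p≤ m<y = <-trans (<-≤-trans (m<m+n x z<s) x+p≤) m<y

  sortedLowOrders-sound : ∀ p r x y τ → x + p ≤ suc m → suc m < y → τ ∈ sortedLowOrders x p y r →
                          Valid (InRange x p ∪ InRange y r) τ × LowsIncreasing τ
  sortedLowOrders-sound zero r x y τ _ m<y τ∈ = Valid-resp (≐′-sym (∪-emptyˡ (λ _ → InRange-zero))) v , noLows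
    where
    v = highOrders-sound r y τ (≤-trans (n≤1+n m) (<⇒≤ m<y)) τ∈
    noLows : LowsIncreasing τ
    noLows _ j _ j∈ _ j≤m = ⊥-elim (<⇒≱ (<-trans (n<1+n m) m<y) (≤-trans (proj₁ (proj₁ (spans v) j j∈)) j≤m))
  sortedLowOrders-sound (suc p) zero x y τ x+p≤ m<y τ∈ with ∈-map⁻ (x ∷_) τ∈
  ... | τ′ , τ′∈ , refl =
    sortedLow-∷-low (low<high x+p≤ m<y) (sortedLowOrders-sound p zero (suc x) y τ′ (+-sucˡ-≤ x+p≤) m<y τ′∈)
  sortedLowOrders-sound (suc p) (suc r) x y τ x+p≤ m<y τ∈ with ∈-++⁻ (map (x ∷_) (sortedLowOrders (suc x) p y (suc r))) τ∈
  ... | inj₁ τ∈ˡ with ∈-map⁻ (x ∷_) τ∈ˡ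
  ...   | τ′ , τ′∈ , refl =
    sortedLow-∷-low (low<high x+p≤ m<y) (sortedLowOrders-sound p (suc r) (suc x) y τ′ (+-sucˡ-≤ x+p≤) m<y τ′∈)
  sortedLowOrders-sound (suc p) (suc r) x y τ x+p≤ m<y τ∈ | inj₂ τ∈ʳ with ∈-map⁻ (y ∷_) τ∈ʳ
  ...   | τ′ , τ′∈ , refl =
    sortedLow-∷-high x+p≤ (<-trans (n<1+n m) m<y) (sortedLowOrders-sound (suc p) r x (suc y) τ′ x+p≤ (m<n⇒m<1+n m<y) τ′∈)

  ∈-sortedLowOrders-low : ∀ {x p y} r {τ} → τ ∈ sortedLowOrders (suc x) p y r → x ∷ τ ∈ sortedLowOrders x (suc p) y r
  ∈-sortedLowOrders-low zero τ∈ = ∈-map⁺ (_ ∷_) τ∈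
  ∈-sortedLowOrders-low (suc r) τ∈ = ∈-++⁺ˡ (∈-map⁺ (_ ∷_) τ∈)

  sortedLowOrders-complete : ∀ p r x y τ → 1 ≤ x → x + p ≤ suc m → suc m < y → y + r ≤ suc (2 * m) →
                             Valid (InRange x p ∪ InRange y r) τ → LowsIncreasing τ → τ ∈ sortedLowOrders x p y r
  sortedLowOrders-complete zero r x y τ _ _ m<y y+r≤ v _ =
    highOrders-complete r y τ (≤-trans (n≤1+n m) (<⇒≤ m<y)) y+r≤ (Valid-resp (∪-emptyˡ (λ _ → InRange-zero)) v)
  sortedLowOrders-complete (suc p) r x y [] _ _ _ _ v _ = case proj₂ (spans v) x (inj₁ InRange-start) of λ ()
  sortedLowOrders-complete (suc p) r x y (h ∷ τ′) 1≤x x+p≤ m<y y+r≤ v inc with proj₁ (spans v) h (here refl)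
  ... | inj₁ h∈ with proj₁ InRange-suc h h∈
  ...   | inj₁ refl =
    ∈-sortedLowOrders-low r (sortedLowOrders-complete p r (suc x) y τ′ (s≤s z≤n) (+-sucˡ-≤ x+p≤) m<y y+r≤
      (Valid-∷⁻ InRange-sucˡ [ InRange-below ≤-refl , InRange-below (low<high x+p≤ m<y) ]′ v)
      (LowsIncreasing-∷⁻ (unique v) inc))
  ...   | inj₂ (x<h , h<) = ⊥-elim (¬≺-head (unique v) (inc x h (there x∈) (here refl) x<h h≤m))
    where
    x∈ = Valid-∈-tail v (inj₁ InRange-start) (λ h≡x → <-irrefl (sym h≡x) x<h)
    h≤m = ≤-pred (≤-trans h< (+-sucˡ-≤ x+p≤))
  sortedLowOrders-complete (suc p) zero x y (h ∷ τ′) _ _ _ _ _ _ | inj₂ h∈ = ⊥-elim (InRange-zero h∈)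
  sortedLowOrders-complete (suc p) (suc r) x y (h ∷ τ′) 1≤x x+p≤ m<y y+r≤ v inc | inj₂ h∈ with proj₁ InRange-suc h h∈
  ... | inj₁ refl =
    ∈-++⁺ʳ _ (∈-map⁺ (y ∷_) (sortedLowOrders-complete (suc p) r x (suc y) τ′ 1≤x x+p≤ (m<n⇒m<1+n m<y)
      (+-sucˡ-≤ y+r≤)
      (Valid-∷⁻ InRange-sucʳ [ (λ (_ , y<) → <-asym m<y (<-≤-trans y< x+p≤)) , InRange-below ≤-refl ]′ v)
      (LowsIncreasing-∷⁻ (unique v) inc)))
  ... | inj₂ (y<h , h<) =
    ⊥-elim (N31-as-k (Sat⇒HeadCompatible (sat v)) x y 1≤x x<y y<h (≤-pred (≤-trans h< (+-sucˡ-≤ y+r≤)))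
      (Valid-∈-tail v (inj₁ InRange-start) (λ h≡x → <-asym x<y (subst (y <_) h≡x y<h)))
      (Valid-∈-tail v (inj₂ InRange-start) (λ h≡y → <-irrefl (sym h≡y) y<h))
      (¬B-above (<-trans (n<1+n m) m<y)))
    where
    x<y = low<high x+p≤ m<y

  High : ℕ → Set
  High = InRange (suc m) m

  m≤2m : m ≤ 2 * m
  m≤2m = m≤m+n m (m + 0)

  m<2m : suc m ≤ 2 * m
  m<2m = s≤s (subst (suc k ≤_) (sym (+-suc k (k + 0))) (s≤s (m≤m+n k (k + 0))))

  High-fits : suc m + m ≡ suc (2 * m)
  High-fits = cong (λ z → suc (m + z)) (sym (+-identityʳ m))

  High⁺-fits : suc (suc m) + k ≡ suc (2 * m)
  High⁺-fits = fits k
    where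
    fits : ∀ k → suc (suc (suc k)) + k ≡ suc (2 * suc k)
    fits = solve-∀

  bounds : ∀ {x p y} → x + p ≡ suc m → (InRange x p ∪ High) y → x ≤ y × y ≤ 2 * m
  bounds {y = y} eq (inj₁ (x≤y , y<)) = x≤y , ≤-trans (≤-pred (subst (y <_) eq y<)) m≤2m
  bounds {x} {p} {y} eq (inj₂ (m<y , y<)) = ≤-trans (subst (x ≤_) eq (m≤m+n x p)) m<y , ≤-pred (subst (y <_) High-fits y<)

  orders lowFirstOrders : ℕ → ℕ → List (List ℕ)
  orders x zero = highOrders (suc m) m
  orders x (suc p) = lowFirstOrders x (suc p) ++ map (suc m ∷_) (sortedLowOrders x (suc p) (suc (suc m)) k)
  lowFirstOrders x zero = []
  lowFirstOrders x (suc p) = map (x ∷_) (orders (suc x) p) ++ map (insertSecond x) (lowFirstOrders (suc x) p)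

  lowFirstOrders-head : ∀ p x {σ} → σ ∈ lowFirstOrders x p → ∃[ c ] ∃[ τ ] (σ ≡ c ∷ τ × InRange x p c)
  lowFirstOrders-head (suc p) x σ∈ with ∈-++⁻ (map (x ∷_) (orders (suc x) p)) σ∈
  ... | inj₁ σ∈ˡ with ∈-map⁻ (x ∷_) σ∈ˡ
  ...   | τ , _ , refl = x , τ , refl , InRange-start
  lowFirstOrders-head (suc p) x σ∈ | inj₂ σ∈ʳ with ∈-map⁻ (insertSecond x) σ∈ʳ
  ...   | τ₂ , τ₂∈ , refl with lowFirstOrders-head p (suc x) τ₂∈
  ...     | c , τ , refl , c∈ = c , x ∷ τ , refl , proj₂ InRange-suc c (inj₂ c∈)

  length-orders : ∀ p x → length (orders x p) ≡ orderCount k p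
  length-lowFirstOrders : ∀ p x → length (lowFirstOrders x p) ≡ lowFirstCount k p
  length-orders zero x = length-highOrders m (suc m)
  length-orders (suc p) x =
    trans (length-++ (lowFirstOrders x (suc p)))
          (cong₂ _+_ (length-lowFirstOrders (suc p) x)
                     (trans (length-map (suc m ∷_) (sortedLowOrders x (suc p) (suc (suc m)) k))
                            (length-sortedLowOrders (suc p) k x (suc (suc m)))))
  length-lowFirstOrders zero x = refl
  length-lowFirstOrders (suc p) x =
    trans (length-branches (x ∷_) (insertSecond x) (orders (suc x) p) _)
          (cong₂ _+_ (length-orders p (suc x)) (length-lowFirstOrders p (suc x)))

  orders-unique : ∀ p x → x + p ≡ suc m → Unique (orders x p)
  lowFirstOrders-unique : ∀ p x → x + p ≡ suc m → Unique (lowFirstOrders x p)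
  orders-unique zero x _ = highOrders-unique m (suc m)
  orders-unique (suc p) x eq =
    ++⁺ (lowFirstOrders-unique (suc p) x eq)
        (map⁺ ∷-injectiveʳ (sortedLowOrders-unique (suc p) k x (suc (suc m)) (≤-trans (≤-reflexive eq) (n≤1+n (suc m)))))
        disjoint
    where
    disjoint : Disjoint (lowFirstOrders x (suc p)) (map (suc m ∷_) _)
    disjoint (σ∈ , σ∈′) with lowFirstOrders-head (suc p) x σ∈ | ∈-map⁻ (suc m ∷_) σ∈′
    ... | c , _ , refl , (_ , c<) | _ , _ , e = <-irrefl (∷-injectiveˡ e) (subst (c <_) eq c<)
  lowFirstOrders-unique zero x _ = []
  lowFirstOrders-unique (suc p) x eq =
    ++⁺ (map⁺ ∷-injectiveʳ (orders-unique p (suc x) eq′)) (map⁺ insertSecond-injective (lowFirstOrders-unique p (suc x) eq′))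
        disjoint
    where
    eq′ = +-sucˡ-≡ eq
    disjoint : Disjoint (map (x ∷_) (orders (suc x) p)) (map (insertSecond x) (lowFirstOrders (suc x) p))
    disjoint (σ∈ , σ∈′) with ∈-map⁻ (x ∷_) σ∈ | ∈-map⁻ (insertSecond x) σ∈′
    ... | _ , _ , refl | τ₂ , τ₂∈ , e with lowFirstOrders-head p (suc x) τ₂∈
    ...   | c , _ , refl , (x<c , _) = <-irrefl (∷-injectiveˡ e) x<c

  lowest : ∀ {x p y} → x + suc p ≡ suc m → (InRange (suc x) p ∪ High) y → x < y
  lowest {x} {p} eq q = proj₁ (bounds (+-sucˡ-≡ eq) q)

  orders-sound : ∀ p x τ → x + p ≡ suc m → τ ∈ orders x p → Valid (InRange x p ∪ High) τ
  lowFirstOrders-sound : ∀ p x τ → x + p ≡ suc m → τ ∈ lowFirstOrders x p → Valid (InRange x p ∪ High) τ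
  orders-sound zero x τ _ τ∈ =
    Valid-resp (≐′-sym (∪-emptyˡ (λ _ → InRange-zero))) (highOrders-sound m (suc m) τ (n≤1+n m) τ∈)
  orders-sound (suc p) x τ eq τ∈ =
    [ lowFirstOrders-sound (suc p) x τ eq , highFirst ]′ (∈-++⁻ (lowFirstOrders x (suc p)) τ∈)
    where
    highFirst : τ ∈ map (suc m ∷_) (sortedLowOrders x (suc p) (suc (suc m)) k) → Valid (InRange x (suc p) ∪ High) τ
    highFirst τ∈ʳ with ∈-map⁻ (suc m ∷_) τ∈ʳ
    ... | τ′ , τ′∈ , refl =
      proj₁ (sortedLow-∷-high (≤-reflexive eq) (n<1+n m)
        (sortedLowOrders-sound (suc p) k x (suc (suc m)) τ′ (≤-reflexive eq) (n<1+n (suc m)) τ′∈))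
  lowFirstOrders-sound (suc p) x τ eq τ∈ with ∈-++⁻ (map (x ∷_) (orders (suc x) p)) τ∈
  ... | inj₁ τ∈ˡ with ∈-map⁻ (x ∷_) τ∈ˡ
  ...   | τ′ , τ′∈ , refl =
    Valid-∷-min InRange-sucˡ (λ _ → lowest eq) (orders-sound p (suc x) τ′ (+-sucˡ-≡ eq) τ′∈)
  lowFirstOrders-sound (suc p) x τ eq τ∈ | inj₂ τ∈ʳ with ∈-map⁻ (insertSecond x) τ∈ʳ
  ...   | τ₂ , τ₂∈ , refl with lowFirstOrders-head p (suc x) τ₂∈
  ...     | c , τ′ , refl , (_ , c<) =
    Valid-resp (≐′-sym InRange-sucˡ)
      (Valid-insertSecond (λ _ → lowest eq) (λ j 1<j j<c → 1<j , ≤-trans (<⇒≤ j<c) c≤m)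
        (lowFirstOrders-sound p (suc x) (c ∷ τ′) eq′ τ₂∈))
    where
    eq′ = +-sucˡ-≡ eq
    c≤m = ≤-pred (subst (c <_) eq′ c<)

  -- A low head h forces the least remaining element x < h into second place.
  lowHead-second : ∀ {P h h₂ x τ} → Valid P (h ∷ h₂ ∷ τ) → 1 ≤ x → x < h → h ≤ m →
                   x ∈ τ → x < h₂ → h₂ ≤ 2 * m → ⊥
  lowHead-second v 1≤x x<h h≤m x∈ x<h₂ h₂≤n with <-cmp _ _
  ... | tri< h₂<h _ _ = ¬≺-head (unique-tail (unique v))
          (N13-as-k (Sat⇒HeadCompatible (sat v)) _ _ 1≤x x<h₂ h₂<h (≤-trans h≤m m≤2m) (there x∈) (here refl)
            (≤-<-trans 1≤x x<h₂ , ≤-trans (<⇒≤ h₂<h) h≤m))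
  ... | tri≈ _ h₂≡h _ = Unique[x∷xs]⇒x∉xs (unique v) (here (sym h₂≡h))
  ... | tri> _ _ h<h₂ = ¬≺-head (unique-tail (unique v))
          (N13-as-j (Sat⇒HeadCompatible (sat v)) (≤-<-trans 1≤x x<h , h≤m) _ _ 1≤x x<h h<h₂ h₂≤n (there x∈) (here refl))

  orders-complete : ∀ p x τ → 1 ≤ x → x + p ≡ suc m → Valid (InRange x p ∪ High) τ → τ ∈ orders x p
  lowFirstOrders-complete : ∀ p x h τ → 1 ≤ x → x + p ≡ suc m → InRange x p h →
                            Valid (InRange x p ∪ High) (h ∷ τ) → h ∷ τ ∈ lowFirstOrders x p
  orders-complete zero x τ _ _ v =
    highOrders-complete m (suc m) τ (n≤1+n m) (≤-reflexive High-fits) (Valid-resp (∪-emptyˡ (λ _ → InRange-zero)) v)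
  orders-complete (suc p) x [] _ _ v = case proj₂ (spans v) x (inj₁ InRange-start) of λ ()
  orders-complete (suc p) x (h ∷ τ) 1≤x eq v =
    [ (λ h∈ → ∈-++⁺ˡ (lowFirstOrders-complete (suc p) x h τ 1≤x eq h∈ v)) , ∈-++⁺ʳ _ ∘ highFirst ]′
      (proj₁ (spans v) h (here refl))
    where
    x<1+m = <-≤-trans (m<m+n x z<s) (≤-reflexive eq)
    highFirst : High h → h ∷ τ ∈ map (suc m ∷_) (sortedLowOrders x (suc p) (suc (suc m)) k)
    highFirst h∈ with proj₁ InRange-suc h h∈
    ... | inj₁ refl =
      ∈-map⁺ (suc m ∷_) (sortedLowOrders-complete (suc p) k x (suc (suc m)) τ 1≤x (≤-reflexive eq) ≤-refl
        (≤-reflexive High⁺-fits)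
        (Valid-∷⁻ InRange-sucʳ [ (λ (_ , m<) → <-irrefl refl (subst (suc m <_) eq m<)) , InRange-below ≤-refl ]′ v)
        (HeadCompatible⇒LowsIncreasing (n<1+n m) m<2m (λ y y∈ → ≤-trans 1≤x (proj₁ (bounds eq (proj₁ (spans v) y (there y∈)))))
          (Sat⇒HeadCompatible (sat v))))
    ... | inj₂ (m<h , h<) =
      ⊥-elim (N31-as-k (Sat⇒HeadCompatible (sat v)) x (suc m) 1≤x x<1+m m<h (≤-pred (≤-trans h< (≤-reflexive High⁺-fits)))
        (Valid-∈-tail v (inj₁ InRange-start) (λ h≡x → <-asym x<1+m (subst (suc m <_) h≡x m<h)))
        (Valid-∈-tail v (inj₂ InRange-start) (λ h≡m → <-irrefl (sym h≡m) m<h))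
        (¬B-above (n<1+n m)))
  lowFirstOrders-complete zero x h τ _ _ h∈ _ = ⊥-elim (InRange-zero h∈)
  lowFirstOrders-complete (suc p) x h τ 1≤x eq h∈ v with proj₁ InRange-suc h h∈
  ... | inj₁ refl =
    ∈-++⁺ˡ (∈-map⁺ (x ∷_) (orders-complete p (suc x) τ (s≤s z≤n) (+-sucˡ-≡ eq)
      (Valid-∷⁻ InRange-sucˡ (λ q → <-irrefl refl (lowest eq q)) v)))
  lowFirstOrders-complete (suc p) x h [] _ _ _ v | inj₂ (x<h , _) =
    case Valid-∈-tail v (inj₁ InRange-start) (λ h≡x → <-irrefl (sym h≡x) x<h) of λ ()
  lowFirstOrders-complete (suc p) x h (h₂ ∷ τ) 1≤x eq _ v | inj₂ (x<h , h<) with h₂ ≟ x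
  ... | yes refl =
    ∈-++⁺ʳ _ (∈-map⁺ (insertSecond x) (lowFirstOrders-complete p (suc x) h τ (s≤s z≤n) eq′ (x<h , h<)
      (Valid-insertSecond⁻ (λ q → <-irrefl refl (lowest eq q)) (Valid-resp InRange-sucˡ v))))
    where
    eq′ = +-sucˡ-≡ eq
  ... | no h₂≢x =
    ⊥-elim (lowHead-second v 1≤x x<h h≤m x∈ (≤∧≢⇒< (proj₁ h₂-bounds) (h₂≢x ∘ sym)) (proj₂ h₂-bounds))
    where
    h≤m = ≤-pred (subst (h <_) (+-sucˡ-≡ eq) h<)
    h₂-bounds = bounds eq (proj₁ (spans v) h₂ (there (here refl)))
    x∈ : x ∈ τ
    x∈ with Valid-∈-tail v (inj₁ InRange-start) (λ h≡x → <-irrefl (sym h≡x) x<h)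
    ... | here x≡h₂ = ⊥-elim (h₂≢x (sym x≡h₂))
    ... | there x∈τ = x∈τ

  Low∪High : InRange 1 m ∪ High ≐′ InRange 1 (2 * m)
  Low∪High = to , from
    where
    to : ∀ y → (InRange 1 m ∪ High) y → InRange 1 (2 * m) y
    to y q = proj₁ (bounds refl q) , s≤s (proj₂ (bounds refl q))
    from : ∀ y → InRange 1 (2 * m) y → (InRange 1 m ∪ High) y
    from y (1≤y , y<) with y ≤? m
    ... | yes y≤m = inj₁ (1≤y , s≤s y≤m)
    ... | no y≰m = inj₂ (≰⇒> y≰m , subst (y <_) (sym High-fits) y<)

  orders-enumerate : ∀ σ → σ ∈ orders 1 m ⇔ InD (2 * m) (B2to m) σ
  orders-enumerate σ = mk⇔ sound complete
    where
    range : InRange 1 m ∪ High ≐′ (λ y → y ∈ oneTo (2 * m))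
    range = ≐′-trans Low∪High (≐′-sym (oneTo-spans (2 * m)))
    sound : σ ∈ orders 1 m → InD (2 * m) (B2to m) σ
    sound σ∈ = Equivalence.from (↭⇔Unique×Spans (oneTo-unique (2 * m))) (unique v , spans v) , sat v
      where
      v = Valid-resp range (orders-sound m 1 σ refl σ∈)
    complete : InD (2 * m) (B2to m) σ → σ ∈ orders 1 m
    complete (σ↭ , st) with Equivalence.to (↭⇔Unique×Spans (oneTo-unique (2 * m))) σ↭
    ... | u , sp = orders-complete m 1 σ ≤-refl refl (Valid-resp (≐′-sym range) (valid u sp st))

mainTheorem10 : (m : ℕ) → 2 ≤ m → fIs (2 * m) (B2to m) (rhs m)
mainTheorem10 (suc (suc k)) (s≤s (s≤s z≤n)) =
  orders 1 m , orders-unique m 1 refl , orders-enumerate , trans (length-orders m 1) (orderCount≡rhs k)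
  where
  open Enumeration (suc k)
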